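{- Let $\mathcal{E}$ be a category satisfying (E1) and (E2). Then for every object $e$ of $\mathcal{E}$, the coslice category $e/\mathcal{E}$ also satisfies (E1) and (E2).
   Context: (E1): the category has all finite limits and all small colimits. (E2): the category is equipped with a proper factorisation system $(\mathcal{Q},\mathcal{M})$ (every morphism factors as $m\circ e$ with $e\in\mathcal{Q}$, $m\in\mathcal{M}$; $\mathcal{Q}$ is exactly the class with the left lifting property against $\mathcal{M}$ and $\mathcal{M}$ exactly the class with the right lifting property against $\mathcal{Q}$; $\mathcal{Q}$-morphisms are epic, $\mathcal{M}$-morphisms, called embeddings, are monic) such that: embeddings are stable under pushouts along embeddings; pushout squares of embeddings are also pullback squares; and pushout squares of embeddings are stable under pullbacks along embeddings. The coslice $e/\mathcal{E}$ has objects the morphisms with domain $e$ and morphisms $f\colon(e\to a)\to(e\to b)$ the arrows $f\colon a\to b$ making the triangle commute. -}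

module Defs where

open import Level using (Level; _⊔_; suc; 0ℓ)
open import Data.Nat using (ℕ)
open import Data.Fin using (Fin)
open import Data.Product using (Σ; Σ-syntax; ∃; _×_; _,_; proj₁; proj₂)
open import Relation.Binary using (IsEquivalence)
open import Relation.Binary.PropositionalEquality using (_≡_)

record Category (o ℓ e : Level) : Set (suc (o ⊔ ℓ ⊔ e)) where
  infixr 9 _∘_
  infix 4 _≈_ _⇒_
  field
    Obj : Set o
    _⇒_ : Obj → Obj → Set ℓ
    _≈_ : ∀ {A B} → A ⇒ B → A ⇒ B → Set e
    id : ∀ {A} → A ⇒ A
    _∘_ : ∀ {A B C} → B ⇒ C → A ⇒ B → A ⇒ C
    assoc : ∀ {A B C D} {f : A ⇒ B} {g : B ⇒ C} {h : C ⇒ D} →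
            (h ∘ g) ∘ f ≈ h ∘ (g ∘ f)
    identityˡ : ∀ {A B} {f : A ⇒ B} → id ∘ f ≈ f
    identityʳ : ∀ {A B} {f : A ⇒ B} → f ∘ id ≈ f
    equiv : ∀ {A B} → IsEquivalence (_≈_ {A} {B})
    ∘-resp-≈ : ∀ {A B C} {f h : B ⇒ C} {g i : A ⇒ B} →
               f ≈ h → g ≈ i → f ∘ g ≈ h ∘ i

record Functor {o ℓ e o′ ℓ′ e′ : Level}
               (J : Category o ℓ e) (C : Category o′ ℓ′ e′)
               : Set (o ⊔ ℓ ⊔ e ⊔ o′ ⊔ ℓ′ ⊔ e′) where
  private
    module J = Category J
    module C = Category C
  field
    F₀ : J.Obj → C.Obj
    F₁ : ∀ {A B} → A J.⇒ B → F₀ A C.⇒ F₀ B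
    identity : ∀ {A} → F₁ (J.id {A}) C.≈ C.id
    homomorphism : ∀ {X Y Z} {f : X J.⇒ Y} {g : Y J.⇒ Z} →
                   F₁ (g J.∘ f) C.≈ F₁ g C.∘ F₁ f
    F-resp-≈ : ∀ {A B} {f g : A J.⇒ B} → f J.≈ g → F₁ f C.≈ F₁ g

IsFinite : ∀ {o ℓ e} → Category o ℓ e → Set (o ⊔ ℓ ⊔ e)
IsFinite J =
  (Σ[ n ∈ ℕ ] Σ[ enum ∈ (Fin n → Obj) ] (∀ a → ∃ λ i → enum i ≡ a)) ×
  (∀ a b → Σ[ m ∈ ℕ ] Σ[ h ∈ (Fin m → a ⇒ b) ] (∀ f → ∃ λ k → f ≈ h k))
  where open Category J

module _ {o ℓ e : Level} (C : Category o ℓ e) where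
  open Category C

  module _ {o′ ℓ′ e′ : Level} {J : Category o′ ℓ′ e′} (F : Functor J C) where
    private
      module J = Category J
    open Functor F

    record Cone : Set (o ⊔ ℓ ⊔ e ⊔ o′ ⊔ ℓ′) where
      field
        apex : Obj
        ψ : ∀ j → apex ⇒ F₀ j
        commute : ∀ {i j} (f : i J.⇒ j) → F₁ f ∘ ψ i ≈ ψ j

    record Limit : Set (o ⊔ ℓ ⊔ e ⊔ o′ ⊔ ℓ′) where
      field
        cone : Cone
      open Cone cone
      field
        universal : ∀ (K : Cone) →
          Σ[ u ∈ Cone.apex K ⇒ apex ]
            ((∀ j → ψ j ∘ u ≈ Cone.ψ K j) ×
             (∀ (v : Cone.apex K ⇒ apex) → (∀ j → ψ j ∘ v ≈ Cone.ψ K j) → v ≈ u))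

    record Cocone : Set (o ⊔ ℓ ⊔ e ⊔ o′ ⊔ ℓ′) where
      field
        coapex : Obj
        ψ : ∀ j → F₀ j ⇒ coapex
        commute : ∀ {i j} (f : i J.⇒ j) → ψ j ∘ F₁ f ≈ ψ i

    record Colimit : Set (o ⊔ ℓ ⊔ e ⊔ o′ ⊔ ℓ′) where
      field
        cocone : Cocone
      open Cocone cocone
      field
        universal : ∀ (K : Cocone) →
          Σ[ u ∈ coapex ⇒ Cocone.coapex K ]
            ((∀ j → u ∘ ψ j ≈ Cocone.ψ K j) ×
             (∀ (v : coapex ⇒ Cocone.coapex K) → (∀ j → v ∘ ψ j ≈ Cocone.ψ K j) → v ≈ u))

  HasFiniteLimits : Set (suc 0ℓ ⊔ o ⊔ ℓ ⊔ e)
  HasFiniteLimits = (J : Category 0ℓ 0ℓ 0ℓ) → IsFinite J → (F : Functor J C) → Limit F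

  HasColimits : (o′ ℓ′ e′ : Level) → Set (suc (o′ ⊔ ℓ′ ⊔ e′) ⊔ o ⊔ ℓ ⊔ e)
  HasColimits o′ ℓ′ e′ = (J : Category o′ ℓ′ e′) → (F : Functor J C) → Colimit F

  E1 : (o′ ℓ′ e′ : Level) → Set (suc (o′ ⊔ ℓ′ ⊔ e′) ⊔ o ⊔ ℓ ⊔ e)
  E1 o′ ℓ′ e′ = HasFiniteLimits × HasColimits o′ ℓ′ e′

  MorClass : (p : Level) → Set (o ⊔ ℓ ⊔ suc p)
  MorClass p = ∀ {A B} → A ⇒ B → Set p

  _⧄_ : ∀ {A B X Y} → A ⇒ B → X ⇒ Y → Set (ℓ ⊔ e)
  _⧄_ {A} {B} {X} {Y} q m =
    ∀ (u : A ⇒ X) (v : B ⇒ Y) → m ∘ u ≈ v ∘ q →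
      Σ[ d ∈ B ⇒ X ] (d ∘ q ≈ u × m ∘ d ≈ v)

  Epic : ∀ {A B} → A ⇒ B → Set (o ⊔ ℓ ⊔ e)
  Epic {A} {B} f = ∀ {X} (g h : B ⇒ X) → g ∘ f ≈ h ∘ f → g ≈ h

  Monic : ∀ {A B} → A ⇒ B → Set (o ⊔ ℓ ⊔ e)
  Monic {A} {B} f = ∀ {X} (g h : X ⇒ A) → f ∘ g ≈ f ∘ h → g ≈ h

  record IsPushout {A B C′ P : Obj} (f : A ⇒ B) (g : A ⇒ C′)
                   (i₁ : B ⇒ P) (i₂ : C′ ⇒ P) : Set (o ⊔ ℓ ⊔ e) where
    field
      commute : i₁ ∘ f ≈ i₂ ∘ g
      universal : ∀ {X} (h₁ : B ⇒ X) (h₂ : C′ ⇒ X) → h₁ ∘ f ≈ h₂ ∘ g →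
        Σ[ u ∈ P ⇒ X ] ((u ∘ i₁ ≈ h₁ × u ∘ i₂ ≈ h₂) ×
          (∀ (v : P ⇒ X) → v ∘ i₁ ≈ h₁ → v ∘ i₂ ≈ h₂ → v ≈ u))

  record IsPullback {Q B C′ P : Obj} (p₁ : Q ⇒ B) (p₂ : Q ⇒ C′)
                    (f : B ⇒ P) (g : C′ ⇒ P) : Set (o ⊔ ℓ ⊔ e) where
    field
      commute : f ∘ p₁ ≈ g ∘ p₂
      universal : ∀ {X} (h₁ : X ⇒ B) (h₂ : X ⇒ C′) → f ∘ h₁ ≈ g ∘ h₂ →
        Σ[ u ∈ X ⇒ Q ] ((p₁ ∘ u ≈ h₁ × p₂ ∘ u ≈ h₂) ×
          (∀ (v : X ⇒ Q) → p₁ ∘ v ≈ h₁ → p₂ ∘ v ≈ h₂ → v ≈ u))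

  record ProperFactorisationSystem (p : Level) : Set (o ⊔ ℓ ⊔ e ⊔ suc p) where
    field
      𝒬 : MorClass p
      ℳ : MorClass p
      factorise : ∀ {A B} (f : A ⇒ B) →
        Σ[ X ∈ Obj ] Σ[ q ∈ A ⇒ X ] Σ[ m ∈ X ⇒ B ] (𝒬 q × ℳ m × m ∘ q ≈ f)
      𝒬-is-llp : ∀ {A B} (f : A ⇒ B) →
        (𝒬 f → ∀ {X Y} (m : X ⇒ Y) → ℳ m → f ⧄ m) ×
        ((∀ {X Y} (m : X ⇒ Y) → ℳ m → f ⧄ m) → 𝒬 f)
      ℳ-is-rlp : ∀ {X Y} (m : X ⇒ Y) →
        (ℳ m → ∀ {A B} (f : A ⇒ B) → 𝒬 f → f ⧄ m) ×
        ((∀ {A B} (f : A ⇒ B) → 𝒬 f → f ⧄ m) → ℳ m)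
      𝒬-epic : ∀ {A B} (f : A ⇒ B) → 𝒬 f → Epic f
      ℳ-monic : ∀ {A B} (f : A ⇒ B) → ℳ f → Monic f

  record E2 (p : Level) : Set (o ⊔ ℓ ⊔ e ⊔ suc p) where
    field
      fs : ProperFactorisationSystem p
    open ProperFactorisationSystem fs
    field
      pushout-stable : ∀ {A B C′ P} (f : A ⇒ B) (g : A ⇒ C′)
        (i₁ : B ⇒ P) (i₂ : C′ ⇒ P) → ℳ f → ℳ g → IsPushout f g i₁ i₂ → ℳ i₂
      pushout⇒pullback : ∀ {A B C′ P} (f : A ⇒ B) (g : A ⇒ C′)
        (i₁ : B ⇒ P) (i₂ : C′ ⇒ P) → ℳ f → ℳ g → IsPushout f g i₁ i₂ →
        IsPullback f g i₁ i₂
      -- pushout squares of embeddings are stable under pullback along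
      -- an embedding n : D ⇒ P
      pushout-pullback-stable : ∀ {A B C′ P} (f : A ⇒ B) (g : A ⇒ C′)
        (i₁ : B ⇒ P) (i₂ : C′ ⇒ P) → ℳ f → ℳ g → IsPushout f g i₁ i₂ →
        ∀ {D} (n : D ⇒ P) → ℳ n →
        ∀ {A′ B′ C″} (a : A′ ⇒ A) (d₀ : A′ ⇒ D) → IsPullback a d₀ (i₁ ∘ f) n →
        ∀ (b : B′ ⇒ B) (d₁ : B′ ⇒ D) → IsPullback b d₁ i₁ n →
        ∀ (c : C″ ⇒ C′) (d₂ : C″ ⇒ D) → IsPullback c d₂ i₂ n →
        ∀ (f′ : A′ ⇒ B′) (g′ : A′ ⇒ C″) →
        b ∘ f′ ≈ f ∘ a → d₁ ∘ f′ ≈ d₀ →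
        c ∘ g′ ≈ g ∘ a → d₂ ∘ g′ ≈ d₀ →
        IsPushout f′ g′ d₁ d₂

Coslice : ∀ {o ℓ e} (C : Category o ℓ e) → Category.Obj C →
          Category (o ⊔ ℓ) (ℓ ⊔ e) e
Coslice C x = record
  { Obj = Σ[ a ∈ Obj ] (x ⇒ a)
  ; _⇒_ = λ { (a , s) (b , t) → Σ[ h ∈ a ⇒ b ] (h ∘ s ≈ t) }
  ; _≈_ = λ h k → proj₁ h ≈ proj₁ k
  ; id = id , identityˡ
  ; _∘_ = λ { (h , p) (k , q) → h ∘ k , E.trans assoc (E.trans (∘-resp-≈ E.refl q) p) }
  ; assoc = assoc
  ; identityˡ = identityˡ
  ; identityʳ = identityʳ
  ; equiv = record { refl = E.refl ; sym = E.sym ; trans = E.trans }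
  ; ∘-resp-≈ = ∘-resp-≈
  }
  where
    open Category C
    module E {A B} = IsEquivalence (equiv {A} {B})

-- The forgetful functor from x/C to C creates finite limits, and a colimit of
-- F : J → x/C is the colimit in C of F with x adjoined as an initial object.
-- Pushouts in x/C are exactly the pushouts in C of the underlying maps; so are
-- pullbacks, because X ↦ X + x is left adjoint to the forgetful functor.  With
-- 𝒬 and ℳ the coslice maps whose underlying maps lie in 𝒬 and ℳ, every axiom
-- of (E2) is thus inherited from C.  The one non-formal point is that a coslice
-- map with the right lifting property against 𝒬 lies in ℳ: it is a retract of
-- the ℳ-part of its factorisation.
module Submission where

open import Defs
open import Level using (Level; Lift; lift; lower; _⊔_)
open import Data.Product using (_×_; _,_; proj₁; proj₂)
open import Data.Maybe using (Maybe; nothing; just)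
open import Data.Bool using (Bool; true; false)
open import Data.Unit using (⊤)
open import Data.Empty using (⊥)
open import Relation.Binary using (Setoid; IsEquivalence)
open import Relation.Binary.PropositionalEquality using (_≡_; refl; trans)
import Relation.Binary.Reasoning.Setoid as SetoidReasoning

module HomReasoning {o ℓ e} (C : Category o ℓ e) where
  open Category C

  hom-setoid : ∀ {A B} → Setoid ℓ e
  hom-setoid {A} {B} = record { Carrier = A ⇒ B ; _≈_ = _≈_ ; isEquivalence = equiv }

  module _ {A B : Obj} where
    open IsEquivalence (equiv {A} {B}) public
      renaming (refl to ≈-refl; sym to ≈-sym; trans to ≈-trans)
    open SetoidReasoning (hom-setoid {A} {B}) public

  infixr 4 _⟩∘⟨_
  _⟩∘⟨_ : ∀ {A B D} {f h : B ⇒ D} {g i : A ⇒ B} → f ≈ h → g ≈ i → f ∘ g ≈ h ∘ i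
  _⟩∘⟨_ = ∘-resp-≈

  pullˡ : ∀ {A B D E} {f : D ⇒ E} {g : B ⇒ D} {h : B ⇒ E} {k : A ⇒ B} →
          f ∘ g ≈ h → f ∘ (g ∘ k) ≈ h ∘ k
  pullˡ fg≈h = ≈-trans (≈-sym assoc) (fg≈h ⟩∘⟨ ≈-refl)

  pullʳ : ∀ {A B D E} {f : D ⇒ E} {g : B ⇒ D} {h : A ⇒ D} {k : A ⇒ B} →
          g ∘ k ≈ h → (f ∘ g) ∘ k ≈ f ∘ h
  pullʳ gk≈h = ≈-trans assoc (≈-refl ⟩∘⟨ gk≈h)

Discrete₂ : (o ℓ e : Level) → Category o ℓ e
Discrete₂ o ℓ e = record
  { Obj = Lift o Bool
  ; _⇒_ = λ a b → Lift ℓ (lower a ≡ lower b)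
  ; _≈_ = λ _ _ → Lift e ⊤
  ; id = lift refl
  ; _∘_ = λ q p → lift (trans (lower p) (lower q))
  ; assoc = _
  ; identityˡ = _
  ; identityʳ = _
  ; equiv = record {}
  ; ∘-resp-≈ = _
  }

module _ {o ℓ e} (J : Category o ℓ e) where
  private module J = Category J

  Hom◁ : Maybe J.Obj → Maybe J.Obj → Set ℓ
  Hom◁ nothing  _        = Lift ℓ ⊤
  Hom◁ (just _) nothing  = Lift ℓ ⊥
  Hom◁ (just i) (just j) = i J.⇒ j

  record _⇒◁_ (a b : Maybe J.Obj) : Set ℓ where
    constructor ⟨_⟩
    field hom : Hom◁ a b

  infix 4 _≈◁_
  infixr 9 _∘◁_

  Eq◁ : ∀ {a b} → a ⇒◁ b → a ⇒◁ b → Set e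
  Eq◁ {just _} {just _} ⟨ f ⟩ ⟨ g ⟩ = f J.≈ g
  Eq◁ _ _ = Lift e ⊤

  record _≈◁_ {a b} (f g : a ⇒◁ b) : Set e where
    constructor ⟨_⟩
    field eq : Eq◁ f g

  id◁ : ∀ {a} → a ⇒◁ a
  id◁ {nothing} = ⟨ _ ⟩
  id◁ {just _}  = ⟨ J.id ⟩

  _∘◁_ : ∀ {a b c} → b ⇒◁ c → a ⇒◁ b → a ⇒◁ c
  _∘◁_ {nothing} _ _ = ⟨ _ ⟩
  _∘◁_ {just _} {just _} {just _} ⟨ g ⟩ ⟨ f ⟩ = ⟨ g J.∘ f ⟩
  _∘◁_ {just _} {just _} {nothing} ⟨ () ⟩ _
  _∘◁_ {just _} {nothing} _ ⟨ () ⟩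

  _◁ : Category o ℓ e
  _◁ = record
    { Obj = Maybe J.Obj
    ; _⇒_ = _⇒◁_
    ; _≈_ = _≈◁_
    ; id = id◁
    ; _∘_ = _∘◁_
    ; assoc = assoc◁
    ; identityˡ = identityˡ◁
    ; identityʳ = identityʳ◁
    ; equiv = record { refl = refl◁ ; sym = sym◁ ; trans = trans◁ }
    ; ∘-resp-≈ = ∘-resp-≈◁
    }
    where
    assoc◁ : ∀ {a b c d} {f : a ⇒◁ b} {g : b ⇒◁ c} {h : c ⇒◁ d} →
             (h ∘◁ g) ∘◁ f ≈◁ h ∘◁ (g ∘◁ f)
    assoc◁ {nothing} = _
    assoc◁ {just _} {d = nothing} = _
    assoc◁ {just _} {just _} {just _} {just _} = ⟨ J.assoc ⟩
    assoc◁ {just _} {nothing} {d = just _} {f = ⟨ () ⟩}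
    assoc◁ {just _} {just _} {nothing} {just _} {g = ⟨ () ⟩}

    identityˡ◁ : ∀ {a b} {f : a ⇒◁ b} → id◁ ∘◁ f ≈◁ f
    identityˡ◁ {nothing} = _
    identityˡ◁ {just _} {nothing} = _
    identityˡ◁ {just _} {just _} = ⟨ J.identityˡ ⟩

    identityʳ◁ : ∀ {a b} {f : a ⇒◁ b} → f ∘◁ id◁ ≈◁ f
    identityʳ◁ {nothing} = _
    identityʳ◁ {just _} {nothing} = _
    identityʳ◁ {just _} {just _} = ⟨ J.identityʳ ⟩

    refl◁ : ∀ {a b} {f : a ⇒◁ b} → f ≈◁ f
    refl◁ {nothing} = _
    refl◁ {just _} {nothing} = _
    refl◁ {just _} {just _} = ⟨ IsEquivalence.refl J.equiv ⟩

    sym◁ : ∀ {a b} {f g : a ⇒◁ b} → f ≈◁ g → g ≈◁ f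
    sym◁ {nothing} = _
    sym◁ {just _} {nothing} = _
    sym◁ {just _} {just _} ⟨ p ⟩ = ⟨ IsEquivalence.sym J.equiv p ⟩

    trans◁ : ∀ {a b} {f g h : a ⇒◁ b} → f ≈◁ g → g ≈◁ h → f ≈◁ h
    trans◁ {nothing} = _
    trans◁ {just _} {nothing} = _
    trans◁ {just _} {just _} ⟨ p ⟩ ⟨ q ⟩ = ⟨ IsEquivalence.trans J.equiv p q ⟩

    ∘-resp-≈◁ : ∀ {a b c} {f h : b ⇒◁ c} {g i : a ⇒◁ b} →
                f ≈◁ h → g ≈◁ i → (f ∘◁ g) ≈◁ (h ∘◁ i)
    ∘-resp-≈◁ {nothing} = _
    ∘-resp-≈◁ {just _} {c = nothing} = _
    ∘-resp-≈◁ {just _} {just _} {just _} ⟨ p ⟩ ⟨ q ⟩ = ⟨ J.∘-resp-≈ p q ⟩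
    ∘-resp-≈◁ {just _} {nothing} {just _} {g = ⟨ () ⟩}

module _ {o ℓ e} (C : Category o ℓ e) where
  open Category C
  open HomReasoning C

  module _ {o′ ℓ′ e′} {J : Category o′ ℓ′ e′} {F : Functor J C} where

    precompose-cocone : (K : Cocone C F) → ∀ {Y} → Cocone.coapex K ⇒ Y → Cocone C F
    precompose-cocone K {Y} h = record
      { coapex = Y
      ; ψ = λ j → h ∘ ψ j
      ; commute = λ f → pullʳ (commute f)
      }
      where open Cocone K

    colimit-ext : (L : Colimit C F) → let open Cocone (Colimit.cocone L) in
                  ∀ {Y} {h k : coapex ⇒ Y} → (∀ j → h ∘ ψ j ≈ k ∘ ψ j) → h ≈ k
    colimit-ext L {h = h} {k} h≈k = ≈-trans (unique h h≈k) (≈-sym (unique k λ _ → ≈-refl))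
      where
      open Colimit L
      unique = proj₂ (proj₂ (universal (precompose-cocone cocone k)))

  pullback-ext : ∀ {Q B D P} {p₁ : Q ⇒ B} {p₂ : Q ⇒ D} {f : B ⇒ P} {g : D ⇒ P} →
                 IsPullback C p₁ p₂ f g → ∀ {X} {h k : X ⇒ Q} →
                 p₁ ∘ h ≈ p₁ ∘ k → p₂ ∘ h ≈ p₂ ∘ k → h ≈ k
  pullback-ext {p₁ = p₁} {p₂} pb {h = h} {k} p₁h≈p₁k p₂h≈p₂k =
    ≈-trans (unique h p₁h≈p₁k p₂h≈p₂k) (≈-sym (unique k ≈-refl ≈-refl))
    where
    open IsPullback pb
    unique = proj₂ (proj₂ (universal (p₁ ∘ k) (p₂ ∘ k) (≈-trans (pullˡ commute) assoc)))

  ⧄-retract : ∀ {A B X Y Z} {f : A ⇒ B} {m : X ⇒ Y} {m′ : Z ⇒ Y} {q : X ⇒ Z} {r : Z ⇒ X} →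
              r ∘ q ≈ id → m ∘ r ≈ m′ → m′ ∘ q ≈ m → _⧄_ C f m′ → _⧄_ C f m
  ⧄-retract {q = q} {r} rq≈id mr≈m′ m′q≈m lifts u v square =
    let (d , d∘f≈q∘u , m′∘d≈v) = lifts (q ∘ u) v (≈-trans (pullˡ m′q≈m) square)
    in r ∘ d
     , ≈-trans (pullʳ d∘f≈q∘u) (≈-trans (pullˡ rq≈id) identityˡ)
     , ≈-trans (pullˡ mr≈m′) m′∘d≈v

  record BinaryCoproduct (A B : Obj) : Set (o ⊔ ℓ ⊔ e) where
    field
      A+B : Obj
      i₁ : A ⇒ A+B
      i₂ : B ⇒ A+B
      [_,_] : ∀ {Y} → A ⇒ Y → B ⇒ Y → A+B ⇒ Y
      inject₁ : ∀ {Y} {f : A ⇒ Y} {g : B ⇒ Y} → [ f , g ] ∘ i₁ ≈ f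
      inject₂ : ∀ {Y} {f : A ⇒ Y} {g : B ⇒ Y} → [ f , g ] ∘ i₂ ≈ g
      +-ext : ∀ {Y} {h k : A+B ⇒ Y} → h ∘ i₁ ≈ k ∘ i₁ → h ∘ i₂ ≈ k ∘ i₂ → h ≈ k

  binary-coproduct : ∀ {o′ ℓ′ e′} → HasColimits C o′ ℓ′ e′ → ∀ A B → BinaryCoproduct A B
  binary-coproduct {o′} {ℓ′} {e′} colimits A B = record
    { A+B = coapex
    ; i₁ = ψ (lift true)
    ; i₂ = ψ (lift false)
    ; [_,_] = λ f g → proj₁ (universal (cocone-on f g))
    ; inject₁ = λ {_} {f} {g} → proj₁ (proj₂ (universal (cocone-on f g))) (lift true)
    ; inject₂ = λ {_} {f} {g} → proj₁ (proj₂ (universal (cocone-on f g))) (lift false)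
    ; +-ext = λ h₁≈k₁ h₂≈k₂ → colimit-ext colimit λ { (lift true) → h₁≈k₁ ; (lift false) → h₂≈k₂ }
    }
    where
    D = Discrete₂ o′ ℓ′ e′
    module D = Category D

    F₀ : D.Obj → Obj
    F₀ (lift true)  = A
    F₀ (lift false) = B

    F₁ : ∀ {a b} → a D.⇒ b → F₀ a ⇒ F₀ b
    F₁ (lift refl) = id

    homomorphism : ∀ {a b c} {f : a D.⇒ b} {g : b D.⇒ c} → F₁ (g D.∘ f) ≈ F₁ g ∘ F₁ f
    homomorphism {f = lift refl} {lift refl} = ≈-sym identityˡ

    pair : Functor D C
    pair = record
      { F₀ = F₀
      ; F₁ = F₁
      ; identity = ≈-refl
      ; homomorphism = λ {_} {_} {_} {f} {g} → homomorphism {f = f} {g}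
      ; F-resp-≈ = λ { {f = lift refl} {lift refl} _ → ≈-refl }
      }

    colimit : Colimit C pair
    colimit = colimits D pair

    open Colimit colimit
    open Cocone cocone

    cocone-on : ∀ {Y} → A ⇒ Y → B ⇒ Y → Cocone C pair
    cocone-on {Y} f g = record { coapex = Y ; ψ = leg ; commute = λ { (lift refl) → identityʳ } }
      where
      leg : ∀ a → F₀ a ⇒ Y
      leg (lift true)  = f
      leg (lift false) = g

module UnderObject {o ℓ e} (C : Category o ℓ e) (x : Category.Obj C) where
  open Category C
  open HomReasoning C

  x/C : Category (o ⊔ ℓ) (ℓ ⊔ e) e
  x/C = Coslice C x

  private module x/C = Category x/C

  precompose-structure : ∀ {A B} (f : A x/C.⇒ B) {Y} {h : proj₁ B ⇒ Y} {k : proj₁ A ⇒ Y} →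
                         h ∘ proj₁ f ≈ k → h ∘ proj₂ B ≈ k ∘ proj₂ A
  precompose-structure {A} {B} (f , f-under) {h = h} {k} h∘f≈k = begin
    h ∘ proj₂ B           ≈⟨ ≈-refl ⟩∘⟨ f-under ⟨
    h ∘ (f ∘ proj₂ A)     ≈⟨ pullˡ h∘f≈k ⟩
    k ∘ proj₂ A           ∎

  module _ {o′ ℓ′ e′} {J : Category o′ ℓ′ e′} (F : Functor J x/C) where
    private
      module F = Functor F
      module J◁ = Category (J ◁)

    underlying : Functor J C
    underlying = record
      { F₀ = λ j → proj₁ (F.F₀ j)
      ; F₁ = λ f → proj₁ (F.F₁ f)
      ; identity = F.identity
      ; homomorphism = F.homomorphism
      ; F-resp-≈ = F.F-resp-≈
      }

    lift-limit : Limit C underlying → Limit x/C F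
    lift-limit L = record
      { cone = record
        { apex = apex , s
        ; ψ = λ j → ψ j , ψ∘s≈structure j
        ; commute = commute
        }
      ; universal = λ K →
          let open Cone K renaming (apex to K-apex; ψ to K-ψ; commute to K-commute)
              (u , ψ∘u≈K-ψ , unique) =
                universal (record { apex = proj₁ K-apex ; ψ = λ j → proj₁ (K-ψ j) ; commute = K-commute })
              u-under = unique-s (u ∘ proj₂ K-apex) λ j → ≈-trans (pullˡ (ψ∘u≈K-ψ j)) (proj₂ (K-ψ j))
          in (u , u-under) , ψ∘u≈K-ψ , λ v → unique (proj₁ v)
      }
      where
      open Limit L
      open Cone cone
      structure-cone : Cone C underlying
      structure-cone = record
        { apex = x ; ψ = λ j → proj₂ (F.F₀ j) ; commute = λ f → proj₂ (F.F₁ f) }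
      s = proj₁ (universal structure-cone)
      ψ∘s≈structure = proj₁ (proj₂ (universal structure-cone))
      unique-s = proj₂ (proj₂ (universal structure-cone))

    under₀ : J◁.Obj → Obj
    under₀ nothing  = x
    under₀ (just j) = proj₁ (F.F₀ j)

    under₁ : ∀ {a b} → a J◁.⇒ b → under₀ a ⇒ under₀ b
    under₁ {nothing} {nothing} _ = id
    under₁ {nothing} {just j}  _ = proj₂ (F.F₀ j)
    under₁ {just _}  {just _}  ⟨ f ⟩ = proj₁ (F.F₁ f)
    under₁ {just _}  {nothing} ⟨ () ⟩

    underlying◁ : Functor (J ◁) C
    underlying◁ = record
      { F₀ = under₀
      ; F₁ = under₁
      ; identity = λ {a} → identity {a}
      ; homomorphism = λ {a} {b} {c} {f} {g} → homomorphism {a} {b} {c} {f} {g}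
      ; F-resp-≈ = resp
      }
      where
      identity : ∀ {a} → under₁ (J◁.id {a}) ≈ id
      identity {nothing} = ≈-refl
      identity {just _}  = F.identity

      homomorphism : ∀ {a b c} {f : a J◁.⇒ b} {g : b J◁.⇒ c} → under₁ (g J◁.∘ f) ≈ under₁ g ∘ under₁ f
      homomorphism {nothing} {nothing} {nothing} = ≈-sym identityˡ
      homomorphism {nothing} {nothing} {just _}  = ≈-sym identityʳ
      homomorphism {nothing} {just _}  {just _} {g = ⟨ g ⟩} = ≈-sym (proj₂ (F.F₁ g))
      homomorphism {just _}  {just _}  {just _}  = F.homomorphism
      homomorphism {nothing} {just _}  {nothing} {g = ⟨ () ⟩}
      homomorphism {just _}  {nothing} {f = ⟨ () ⟩}
      homomorphism {just _}  {just _}  {nothing} {g = ⟨ () ⟩}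

      resp : ∀ {a b} {f g : a J◁.⇒ b} → f J◁.≈ g → under₁ f ≈ under₁ g
      resp {nothing} {nothing} _ = ≈-refl
      resp {nothing} {just _}  _ = ≈-refl
      resp {just _}  {just _}  ⟨ f≈g ⟩ = F.F-resp-≈ f≈g
      resp {just _}  {nothing} {f = ⟨ () ⟩}

    extend-cocone : Cocone x/C F → Cocone C underlying◁
    extend-cocone K = record { coapex = proj₁ coapex ; ψ = leg ; commute = leg-commute }
      where
      open Cocone K
      leg : ∀ a → under₀ a ⇒ proj₁ coapex
      leg nothing  = proj₂ coapex
      leg (just j) = proj₁ (ψ j)

      leg-commute : ∀ {a b} (f : a J◁.⇒ b) → leg b ∘ under₁ f ≈ leg a
      leg-commute {nothing} {nothing} _ = identityʳ
      leg-commute {nothing} {just j}  _ = proj₂ (ψ j)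
      leg-commute {just _}  {just _}  ⟨ f ⟩ = commute f
      leg-commute {just _}  {nothing} ⟨ () ⟩

    lift-colimit : Colimit C underlying◁ → Colimit x/C F
    lift-colimit L = record
      { cocone = record
        { coapex = coapex , ψ nothing
        ; ψ = λ j → ψ (just j) , commute {nothing} {just j} _
        ; commute = λ f → commute ⟨ f ⟩
        }
      ; universal = λ K →
          let (u , u∘ψ≈leg , unique) = universal (extend-cocone K)
          in (u , u∘ψ≈leg nothing) , (λ j → u∘ψ≈leg (just j))
           , λ v v∘ψ≈leg → unique (proj₁ v) λ { nothing → proj₂ v ; (just j) → v∘ψ≈leg j }
      }
      where
      open Colimit L
      open Cocone cocone

  coslice-finite-limits : HasFiniteLimits C → HasFiniteLimits x/C
  coslice-finite-limits limits J finite F = lift-limit F (limits J finite (underlying F))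

  coslice-colimits : ∀ {o′ ℓ′ e′} → HasColimits C o′ ℓ′ e′ → HasColimits x/C o′ ℓ′ e′
  coslice-colimits colimits J F = lift-colimit F (colimits (J ◁) (underlying◁ F))

  forget-preserves-pushout : ∀ {A B D P} {f : A x/C.⇒ B} {g : A x/C.⇒ D}
    {i₁ : B x/C.⇒ P} {i₂ : D x/C.⇒ P} → IsPushout x/C f g i₁ i₂ →
    IsPushout C (proj₁ f) (proj₁ g) (proj₁ i₁) (proj₁ i₂)
  forget-preserves-pushout {B = B} {D} {f = f} {g} {i₁} po = record
    { commute = commute
    ; universal = λ {X} h₁ h₂ h₁f≈h₂g →
        let h₂-under : h₂ ∘ proj₂ D ≈ h₁ ∘ proj₂ B
            h₂-under = ≈-trans (precompose-structure g (≈-sym h₁f≈h₂g))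
                               (≈-sym (precompose-structure f ≈-refl))
            ((u , _) , u-commutes , unique) =
              universal {X , h₁ ∘ proj₂ B} (h₁ , ≈-refl) (h₂ , h₂-under) h₁f≈h₂g
        in u , u-commutes , λ v v∘i₁≈h₁ → unique (v , precompose-structure i₁ v∘i₁≈h₁) v∘i₁≈h₁
    }
    where open IsPushout po

  forget-reflects-pushout : ∀ {A B D P} {f : A x/C.⇒ B} {g : A x/C.⇒ D}
    {i₁ : B x/C.⇒ P} {i₂ : D x/C.⇒ P} →
    IsPushout C (proj₁ f) (proj₁ g) (proj₁ i₁) (proj₁ i₂) → IsPushout x/C f g i₁ i₂
  forget-reflects-pushout {i₁ = i₁} po = record
    { commute = commute
    ; universal = λ h₁ h₂ h₁f≈h₂g →
        let (u , u-commutes@(u∘i₁≈h₁ , _) , unique) = universal (proj₁ h₁) (proj₁ h₂) h₁f≈h₂g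
            u-under = ≈-trans (precompose-structure i₁ u∘i₁≈h₁) (proj₂ h₁)
        in (u , u-under) , u-commutes , λ v → unique (proj₁ v)
    }
    where open IsPushout po

  forget-reflects-pullback : ∀ {Q B D P} {p₁ : Q x/C.⇒ B} {p₂ : Q x/C.⇒ D}
    {f : B x/C.⇒ P} {g : D x/C.⇒ P} →
    IsPullback C (proj₁ p₁) (proj₁ p₂) (proj₁ f) (proj₁ g) → IsPullback x/C p₁ p₂ f g
  forget-reflects-pullback {p₁ = p₁} {p₂} pb = record
    { commute = commute
    ; universal = λ h₁ h₂ fh₁≈gh₂ →
        let (u , u-commutes@(p₁u≈h₁ , p₂u≈h₂) , unique) = universal (proj₁ h₁) (proj₁ h₂) fh₁≈gh₂
            u-under = pullback-ext C pb
              (≈-trans (pullˡ p₁u≈h₁) (≈-trans (proj₂ h₁) (≈-sym (proj₂ p₁))))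
              (≈-trans (pullˡ p₂u≈h₂) (≈-trans (proj₂ h₂) (≈-sym (proj₂ p₂))))
        in (u , u-under) , u-commutes , λ v → unique (proj₁ v)
    }
    where open IsPullback pb

  module _ (_+x : ∀ X → BinaryCoproduct C X x) where
    private module +x X = BinaryCoproduct (X +x)

    free : Obj → x/C.Obj
    free X = +x.A+B X , +x.i₂ X

    η : ∀ {X} → X ⇒ proj₁ (free X)
    η {X} = +x.i₁ X

    transpose : ∀ {X A} → X ⇒ proj₁ A → free X x/C.⇒ A
    transpose {X} {A} h = +x.[_,_] X h (proj₂ A) , +x.inject₂ X

    transpose-η : ∀ {X A} {h : X ⇒ proj₁ A} → proj₁ (transpose {A = A} h) ∘ η ≈ h
    transpose-η {X} = +x.inject₁ X

    free-ext : ∀ {X A} (h k : free X x/C.⇒ A) → proj₁ h ∘ η ≈ proj₁ k ∘ η → h x/C.≈ k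
    free-ext {X} h k h∘η≈k∘η = +x.+-ext X h∘η≈k∘η (≈-trans (proj₂ h) (≈-sym (proj₂ k)))

    forget-preserves-pullback : ∀ {Q B D P} {p₁ : Q x/C.⇒ B} {p₂ : Q x/C.⇒ D}
      {f : B x/C.⇒ P} {g : D x/C.⇒ P} →
      IsPullback x/C p₁ p₂ f g → IsPullback C (proj₁ p₁) (proj₁ p₂) (proj₁ f) (proj₁ g)
    forget-preserves-pullback {p₁ = p₁} {p₂} {f} {g} pb = record
      { commute = commute
      ; universal = λ h₁ h₂ fh₁≈gh₂ →
          let (u , (p₁u≈h₁ , p₂u≈h₂) , unique) =
                universal (transpose h₁) (transpose h₂)
                  (free-ext (f x/C.∘ transpose h₁) (g x/C.∘ transpose h₂)
                    (≈-trans (pullʳ transpose-η) (≈-trans fh₁≈gh₂ (≈-sym (pullʳ transpose-η)))))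
          in proj₁ u ∘ η
           , (≈-trans (pullˡ p₁u≈h₁) transpose-η , ≈-trans (pullˡ p₂u≈h₂) transpose-η)
           , λ v p₁v≈h₁ p₂v≈h₂ →
               let tv≈u = unique (transpose v)
                            (free-ext (p₁ x/C.∘ transpose v) (transpose h₁)
                              (≈-trans (pullʳ transpose-η) (≈-trans p₁v≈h₁ (≈-sym transpose-η))))
                            (free-ext (p₂ x/C.∘ transpose v) (transpose h₂)
                              (≈-trans (pullʳ transpose-η) (≈-trans p₂v≈h₂ (≈-sym transpose-η))))
               in ≈-trans (≈-sym transpose-η) (tv≈u ⟩∘⟨ ≈-refl)
      }
      where open IsPullback pb

  forget-reflects-⧄ : ∀ {A B X Y} (f : A x/C.⇒ B) (m : X x/C.⇒ Y) →
                      _⧄_ C (proj₁ f) (proj₁ m) → _⧄_ x/C f m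
  forget-reflects-⧄ f _ lifts (u , u-under) (v , _) square =
    let (d , d∘f≈u , m∘d≈v) = lifts u v square
    in (d , ≈-trans (precompose-structure f d∘f≈u) u-under) , d∘f≈u , m∘d≈v

  module _ {p} (fs : ProperFactorisationSystem C p) where
    open ProperFactorisationSystem fs

    ⧄ℳ-forget : ∀ {A B} (f : A x/C.⇒ B) →
      (∀ {X Y} (m : X x/C.⇒ Y) → ℳ (proj₁ m) → _⧄_ x/C f m) →
      ∀ {X Y} (m : X ⇒ Y) → ℳ m → _⧄_ C (proj₁ f) m
    ⧄ℳ-forget {A} {B} f lifts {X} {Y} m m∈ℳ u v square =
      let ((d , _) , d∘f≈u , m∘d≈v) =
            lifts {X , u ∘ proj₂ A} {Y , v ∘ proj₂ B} (m , m-under) m∈ℳ (u , ≈-refl) (v , ≈-refl) square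
      in d , d∘f≈u , m∘d≈v
      where
      m-under : m ∘ (u ∘ proj₂ A) ≈ v ∘ proj₂ B
      m-under = ≈-trans (pullˡ square) (≈-sym (precompose-structure f ≈-refl))

    𝒬⧄-forget : ∀ {X Y} (m : X x/C.⇒ Y) →
      (∀ {A B} (f : A x/C.⇒ B) → 𝒬 (proj₁ f) → _⧄_ x/C f m) →
      ∀ {A B} (f : A ⇒ B) → 𝒬 f → _⧄_ C f (proj₁ m)
    𝒬⧄-forget {X} (m , m-under) lifts f f∈𝒬 =
      let (Z , q , m′ , q∈𝒬 , m′∈ℳ , m′q≈m) = factorise m
          ((r , _) , rq≈id , mr≈m′) =
            lifts {B = Z , q ∘ proj₂ X} (q , ≈-refl) q∈𝒬 x/C.id (m′ , ≈-trans (pullˡ m′q≈m) m-under)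
                  (≈-trans identityʳ (≈-sym m′q≈m))
      in ⧄-retract C rq≈id mr≈m′ m′q≈m (proj₁ (ℳ-is-rlp m′) m′∈ℳ f f∈𝒬)

    coslice-factorisation : ProperFactorisationSystem x/C p
    coslice-factorisation = record
      { 𝒬 = λ f → 𝒬 (proj₁ f)
      ; ℳ = λ m → ℳ (proj₁ m)
      ; factorise = λ {A} {B} (f , f-under) →
          let (Z , q , m , q∈𝒬 , m∈ℳ , mq≈f) = factorise f
          in (Z , q ∘ proj₂ A) , (q , ≈-refl) , (m , ≈-trans (pullˡ mq≈f) f-under) , q∈𝒬 , m∈ℳ , mq≈f
      ; 𝒬-is-llp = λ f →
            (λ f∈𝒬 m m∈ℳ → forget-reflects-⧄ f m (proj₁ (𝒬-is-llp (proj₁ f)) f∈𝒬 (proj₁ m) m∈ℳ))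
          , (λ lifts → proj₂ (𝒬-is-llp (proj₁ f)) (⧄ℳ-forget f lifts))
      ; ℳ-is-rlp = λ m →
            (λ m∈ℳ f f∈𝒬 → forget-reflects-⧄ f m (proj₁ (ℳ-is-rlp (proj₁ m)) m∈ℳ (proj₁ f) f∈𝒬))
          , (λ lifts → proj₂ (ℳ-is-rlp (proj₁ m)) (𝒬⧄-forget m lifts))
      ; 𝒬-epic = λ f f∈𝒬 g h → 𝒬-epic (proj₁ f) f∈𝒬 (proj₁ g) (proj₁ h)
      ; ℳ-monic = λ m m∈ℳ g h → ℳ-monic (proj₁ m) m∈ℳ (proj₁ g) (proj₁ h)
      }

  coslice-E2 : ∀ {p} → (∀ X → BinaryCoproduct C X x) → E2 C p → E2 x/C p
  coslice-E2 _+x E = record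
    { fs = coslice-factorisation fs
    ; pushout-stable = λ f g i₁ i₂ f∈ℳ g∈ℳ po →
        pushout-stable (proj₁ f) (proj₁ g) (proj₁ i₁) (proj₁ i₂) f∈ℳ g∈ℳ (forget-preserves-pushout po)
    ; pushout⇒pullback = λ f g i₁ i₂ f∈ℳ g∈ℳ po →
        forget-reflects-pullback
          (pushout⇒pullback (proj₁ f) (proj₁ g) (proj₁ i₁) (proj₁ i₂) f∈ℳ g∈ℳ (forget-preserves-pushout po))
    ; pushout-pullback-stable = λ f g i₁ i₂ f∈ℳ g∈ℳ po n n∈ℳ a d₀ pb₀ b d₁ pb₁ c d₂ pb₂ f′ g′
                                bf′≈fa d₁f′≈d₀ cg′≈ga d₂g′≈d₀ →
        forget-reflects-pushout
          (pushout-pullback-stable (proj₁ f) (proj₁ g) (proj₁ i₁) (proj₁ i₂) f∈ℳ g∈ℳ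
            (forget-preserves-pushout po) (proj₁ n) n∈ℳ
            (proj₁ a) (proj₁ d₀) (forget-preserves-pullback _+x pb₀)
            (proj₁ b) (proj₁ d₁) (forget-preserves-pullback _+x pb₁)
            (proj₁ c) (proj₁ d₂) (forget-preserves-pullback _+x pb₂)
            (proj₁ f′) (proj₁ g′) bf′≈fa d₁f′≈d₀ cg′≈ga d₂g′≈d₀)
    }
    where open E2 E

lemma5p4 : ∀ {o ℓ e p o′ ℓ′ e′ : Level} (C : Category o ℓ e) →
           E1 C o′ ℓ′ e′ → E2 C p →
           (x : Category.Obj C) →
           E1 (Coslice C x) o′ ℓ′ e′ × E2 (Coslice C x) p
lemma5p4 C (finite-limits , colimits) e2 x =
    (coslice-finite-limits finite-limits , coslice-colimits colimits)
  , coslice-E2 (λ X → binary-coproduct C colimits X x) e2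
  where open UnderObject C x
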